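{- Suppose there exists a difference scheme $DS(m,s;x)$ with $s\ge2$ (so $m=xs$). Then there exists a Latin semi-regular, affine resolvable, STD$(s)$ rectangular design with parameters $v=xs^2$, $b=s(xs-1)$, $r=xs-1$, $k=xs$, $\lambda_1=0$, $\lambda_2=x-1$, $\lambda_3=x$, intersection numbers $q_1=0$, $q_2=x$, and array dimensions $m=xs$, $n=s$.
   Context: For $s\ge2$ let $\mathbb{Z}_s$ be the additive cyclic group of order $s$. A difference scheme $DS(m,s;x)$ is an $m\times m$ matrix with entries in $\mathbb{Z}_s$ such that, for any two distinct columns, the entrywise differences (mod $s$) contain each element of $\mathbb{Z}_s$ exactly $x$ times. A rectangular design (RD) with parameters $v=mn,b,r,k,\lambda_1,\lambda_2,\lambda_3,m,n$ has its treatments arranged in an $m\times n$ array, $b$ blocks of size $k$, replication $r$, and any two distinct treatments occur together in $\lambda_1$ blocks if in the same row, $\lambda_2$ if in the same column, $\lambda_3$ otherwise. It is Latin semi-regular if $\theta_1=\theta_2=0<\theta_3$, where $\theta_1=r-\lambda_1+(m-1)(\lambda_2-\lambda_3)$, $\theta_2=r-\lambda_2+(n-1)(\lambda_1-\lambda_3)$, $\theta_3=r-\lambda_1-\lambda_2+\lambda_3$. A resolvable design (blocks partitioned into classes each containing every treatment exactly once) is affine resolvable if any two distinct blocks of the same class meet in $q_1$ treatments and any two blocks from different classes meet in $q_2$ treatments. It is STD$(s)$ if its incidence matrix (rows grouped by rows of the array) is partitioned into $s\times s$ submatrices each with constant row sums and constant column sums. -}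

module Defs where

open import Data.Bool using (Bool; true; false; if_then_else_; _∧_)
open import Data.Nat as ℕ using (ℕ; _+_; _*_; _∸_; NonZero)
open import Data.Nat.DivMod using (_mod_)
open import Data.Fin using (Fin; zero; suc; toℕ)
open import Data.Fin.Properties using (_≟_)
open import Data.Integer as ℤ using (ℤ; +_)
open import Data.Product using (Σ; _×_; ∃)
open import Relation.Nullary.Decidable using (⌊_⌋)
open import Relation.Binary.PropositionalEquality using (_≡_; _≢_)

count : ∀ {n} → (Fin n → Bool) → ℕ
count {ℕ.zero}  p = 0
count {ℕ.suc n} p = (if p zero then 1 else 0) + count (λ a → p (suc a))

sumFin : ∀ {n} → (Fin n → ℕ) → ℕ
sumFin {ℕ.zero}  f = 0
sumFin {ℕ.suc n} f = f zero + sumFin (λ a → f (suc a))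

count₂ : ∀ {m n} → (Fin m → Fin n → Bool) → ℕ
count₂ p = sumFin (λ i → count (p i))

-- ℤ_s represented by Fin s; difference a - b (mod s)

zsub : ∀ {s} .{{_ : NonZero s}} → Fin s → Fin s → Fin s
zsub {s} a b = (toℕ a + (s ∸ toℕ b)) mod s

-- Difference scheme DS(m,s;x): an m × m matrix D (D i c = entry in row i,
-- column c) over ℤ_s such that for any two distinct columns c, c' the
-- differences D i c - D i c' (i ranging over rows) contain every element
-- of ℤ_s exactly x times.
DS : (m s x : ℕ) .{{_ : NonZero s}} → Set
DS m s x =
  Σ (Fin m → Fin m → Fin s) λ D →
    ∀ (c c' : Fin m) → c ≢ c' → ∀ (g : Fin s) →
      count (λ i → ⌊ zsub (D i c) (D i c') ≟ g ⌋) ≡ x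

-- Rectangular design: treatments are the cells (i , j) of an m × n array
-- (so v = m n), blocks are indexed by Fin b; N i j β = true iff treatment
-- (i , j) lies in block β (blocks may repeat).

record RD (m n b r k λ₁ λ₂ λ₃ : ℕ) : Set where
  field
    N : Fin m → Fin n → Fin b → Bool
    blockSize   : ∀ β → count₂ (λ i j → N i j β) ≡ k
    replication : ∀ i j → count (λ β → N i j β) ≡ r
    sameRow     : ∀ i j j' → j ≢ j' →
                  count (λ β → N i j β ∧ N i j' β) ≡ λ₁
    sameCol     : ∀ i i' j → i ≢ i' →
                  count (λ β → N i j β ∧ N i' j β) ≡ λ₂
    other       : ∀ i i' j j' → i ≢ i' → j ≢ j' →
                  count (λ β → N i j β ∧ N i' j' β) ≡ λ₃

module _ {m n b r k λ₁ λ₂ λ₃ : ℕ} (D : RD m n b r k λ₁ λ₂ λ₃) where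
  open RD D

  θ₁ θ₂ θ₃ : ℤ
  θ₁ = + r ℤ.- + λ₁ ℤ.+ (+ m ℤ.- + 1) ℤ.* (+ λ₂ ℤ.- + λ₃)
  θ₂ = + r ℤ.- + λ₂ ℤ.+ (+ n ℤ.- + 1) ℤ.* (+ λ₁ ℤ.- + λ₃)
  θ₃ = + r ℤ.- + λ₁ ℤ.- + λ₂ ℤ.+ + λ₃

  LatinSemiRegular : Set
  LatinSemiRegular = θ₁ ≡ + 0 × θ₂ ≡ + 0 × + 0 ℤ.< θ₃

  meet : Fin b → Fin b → ℕ
  meet β β' = count₂ (λ i j → N i j β ∧ N i j β')

  IsResolution : ∀ {t} → (Fin b → Fin t) → Set
  IsResolution {t} cls =
    ∀ (c : Fin t) i j → count (λ β → ⌊ cls β ≟ c ⌋ ∧ N i j β) ≡ 1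

  AffineResolvable : (q₁ q₂ : ℕ) → Set
  AffineResolvable q₁ q₂ =
    ∃ λ t → Σ (Fin b → Fin t) λ cls →
      IsResolution cls ×
      (∀ β β' → β ≢ β' → cls β ≡ cls β' → meet β β' ≡ q₁) ×
      (∀ β β' → cls β ≢ cls β' → meet β β' ≡ q₂)

-- STD(s) for a rectangular design whose array has n = s columns: the
-- incidence matrix (rows = treatments grouped by array rows, i.e. into
-- groups of s; columns = blocks) is partitioned into s × s submatrices
-- (the blocks are partitioned by grp into groups of exactly s blocks),
-- each with constant row sums and constant column sums.
module _ {m s b r k λ₁ λ₂ λ₃ : ℕ} (D : RD m s b r k λ₁ λ₂ λ₃) where
  open RD D

  STD : Set
  STD =
    ∃ λ c → Σ (Fin b → Fin c) λ grp →
      (∀ γ → count (λ β → ⌊ grp β ≟ γ ⌋) ≡ s) ×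
      (∀ (i : Fin m) (γ : Fin c) →
        (∃ λ ρ → ∀ j → count (λ β → ⌊ grp β ≟ γ ⌋ ∧ N i j β) ≡ ρ) ×
        (∃ λ κ → ∀ β → grp β ≡ γ → count (λ j → N i j β) ≡ κ))

-- Subtract row 0 of the difference scheme D from all other rows. The treatments are the cells
-- (c , j) of an xs × s array, and for each row ρ ≥ 1 of D and each g ∈ ℤ_s there is a block
-- meeting array row c in column g + D ρ c − D 0 c; the blocks of one ρ form a parallel class.
-- Treatments (c , j), (c' , j') with c ≠ c' share the blocks of the rows ρ ≥ 1 with
-- D ρ c − D ρ c' = (j − j') + (D 0 c − D 0 c'); exactly x rows of D satisfy this, and row 0 is
-- one of them iff j = j'. Blocks of different classes ρ ≠ ρ' meet in the columns c on which
-- D ρ c − D ρ' c takes a prescribed value, so the meet is x because the transpose of a square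
-- difference scheme is again one. That last fact is a double count of the quadruples
-- (i, i', c, c') with D i c − D i' c = D i c' − D i' c': by columns the count is exact, by
-- rows it is bounded below by the sum-of-squares inequality, so all row bounds are attained.

module Submission where

open import Defs
open import Data.Bool using (Bool; true; false; if_then_else_; _∧_)
open import Data.Bool.Properties using (∧-identityʳ)
open import Data.Fin using (Fin; zero; suc; toℕ; fromℕ<; _↑ˡ_; _↑ʳ_; combine; remQuot)
open import Data.Fin.Properties
  using (_≟_; suc-injective; toℕ-injective; toℕ<n; toℕ-fromℕ<; remQuot-combine; combine-remQuot)
open import Data.Integer as ℤ using (ℤ; +_; -_; _-_)
open import Data.Integer.DivMod using (n%ℕd<d; a≡a%ℕn+[a/ℕn]*n)
open import Data.Integer.Divisibility.Signed
  using (_∣_; divides; _∣?_; ∣⇒∣ᵤ; ∣m⇒∣-m; ∣m∣n⇒∣m+n)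
import Data.Integer.Properties as ℤ
open import Data.Integer.Tactic.RingSolver using () renaming (solve-∀ to ℤ-solve-∀)
open import Data.List using (_∷_; [])
open import Data.Nat using (ℕ; zero; suc; _+_; _*_; _∸_; _≤_; _<_; z≤n; s≤s; NonZero)
open import Data.Nat.Divisibility using (>⇒∤) renaming (_∣_ to _ℕ∣_)
open import Data.Nat.Properties
  using (+-*-semiring; +-assoc; +-identityʳ; *-comm; *-identityʳ; *-zeroʳ; ≤-antisym; ≤-trans;
         ≤-reflexive; +-mono-≤; +-monoʳ-≤; +-cancelʳ-≤; +-cancelˡ-≡; m≤m+n; ≤-total; <⇒≤; ≤-<-trans;
         m∸n≤m; m∸n≡0⇒m≤n; m≤n⇒∃[o]m+o≡n; m*n≡0⇒m≡0∨n≡0)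
open import Algebra.Properties.Semiring.Sum +-*-semiring
  using (sum; sum-cong-≗; ∑-distrib-+; ∑-comm; *-distribʳ-sum)
open import Data.Nat.Tactic.RingSolver using () renaming (solve to ℕ-solve)
open import Data.Product using (Σ; ∃; _×_; _,_; proj₁; proj₂; uncurry)
open import Data.Product.Properties using (×-≡,≡→≡)
open import Data.Sum using (inj₁; inj₂; [_,_]′)
open import Function using (_∘_; id; _⇔_; mk⇔; Equivalence)
import Function.Properties.Equivalence as ⇔
open import Relation.Nullary using (¬_; contradiction)
open import Relation.Nullary.Decidable
  using (Dec; yes; no; ⌊_⌋; map′; isYes≗does; does-⇔; ⌊⌋-map′; dec-true; dec-false)
open import Relation.Binary.PropositionalEquality
  using (_≡_; _≢_; _≗_; refl; sym; trans; cong; cong₂; subst; subst₂; module ≡-Reasoning)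

𝟙 : Bool → ℕ
𝟙 b = if b then 1 else 0

⌊⌋-⇔ : ∀ {A B : Set} → A ⇔ B → (a? : Dec A) (b? : Dec B) → ⌊ a? ⌋ ≡ ⌊ b? ⌋
⌊⌋-⇔ A⇔B a? b? = trans (isYes≗does a?) (trans (does-⇔ A⇔B a? b?) (sym (isYes≗does b?)))

⌊⌋-true : ∀ {A : Set} (a? : Dec A) → A → ⌊ a? ⌋ ≡ true
⌊⌋-true a? a = trans (isYes≗does a?) (dec-true a? a)

⌊⌋-false : ∀ {A : Set} (a? : Dec A) → ¬ A → ⌊ a? ⌋ ≡ false
⌊⌋-false a? ¬a = trans (isYes≗does a?) (dec-false a? ¬a)

count-cong : ∀ {n} {p q : Fin n → Bool} → p ≗ q → count p ≡ count q
count-cong {zero}  _   = refl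
count-cong {suc n} p≗q = cong₂ _+_ (cong 𝟙 (p≗q zero)) (count-cong (p≗q ∘ suc))

count-false : ∀ {n} → count {n} (λ _ → false) ≡ 0
count-false {zero}  = refl
count-false {suc n} = count-false {n}

count-true : ∀ {n} → count {n} (λ _ → true) ≡ n
count-true {zero}  = refl
count-true {suc n} = cong suc (count-true {n})

count-≡ : ∀ {n} (a : Fin n) → count (λ b → ⌊ b ≟ a ⌋) ≡ 1
count-≡ {suc n} zero    = cong suc (count-false {n})
count-≡ {suc n} (suc a) =
  trans (count-cong (λ b → ⌊⌋-map′ (cong suc) suc-injective (b ≟ a))) (count-≡ a)

count-≡-∧ : ∀ {n} (a : Fin n) (q : Fin n → Bool) →
  count (λ b → ⌊ b ≟ a ⌋ ∧ q b) ≡ 𝟙 (q a)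
count-≡-∧ {suc n} zero    q = trans (cong (_+_ (𝟙 (q zero))) (count-false {n})) (+-identityʳ _)
count-≡-∧ {suc n} (suc a) q = trans
  (count-cong (λ b → cong (_∧ q (suc b)) (⌊⌋-map′ (cong suc) suc-injective (b ≟ a))))
  (count-≡-∧ a (q ∘ suc))

sumFin-cong : ∀ {n} {f g : Fin n → ℕ} → f ≗ g → sumFin f ≡ sumFin g
sumFin-cong {zero}  _   = refl
sumFin-cong {suc n} f≗g = cong₂ _+_ (f≗g zero) (sumFin-cong (f≗g ∘ suc))

sumFin≡sum : ∀ {n} (f : Fin n → ℕ) → sumFin f ≡ sum f
sumFin≡sum {zero}  f = refl
sumFin≡sum {suc n} f = cong (_+_ (f zero)) (sumFin≡sum (f ∘ suc))

count≡sumFin : ∀ {n} (p : Fin n → Bool) → count p ≡ sumFin (𝟙 ∘ p)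
count≡sumFin {zero}  p = refl
count≡sumFin {suc n} p = cong (_+_ (𝟙 (p zero))) (count≡sumFin (p ∘ suc))

sumFin-const : ∀ {n} c → sumFin {n} (λ _ → c) ≡ n * c
sumFin-const {zero}  c = refl
sumFin-const {suc n} c = cong (_+_ c) (sumFin-const {n} c)

sumFin-comm : ∀ {m n} (f : Fin m → Fin n → ℕ) →
  sumFin (λ a → sumFin (f a)) ≡ sumFin (λ b → sumFin (λ a → f a b))
sumFin-comm f = begin
  sumFin (λ a → sumFin (f a))          ≡⟨ sumFin≡sum (λ a → sumFin (f a)) ⟩
  sum (λ a → sumFin (f a))             ≡⟨ sum-cong-≗ (sumFin≡sum ∘ f) ⟩
  sum (λ a → sum (f a))                ≡⟨ ∑-comm f ⟩
  sum (λ b → sum (λ a → f a b))        ≡⟨ sum-cong-≗ (λ b → sumFin≡sum (λ a → f a b)) ⟨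
  sum (λ b → sumFin (λ a → f a b))     ≡⟨ sumFin≡sum (λ b → sumFin (λ a → f a b)) ⟨
  sumFin (λ b → sumFin (λ a → f a b))  ∎
  where open ≡-Reasoning

sumFin-+ : ∀ {n} (f g : Fin n → ℕ) → sumFin (λ a → f a + g a) ≡ sumFin f + sumFin g
sumFin-+ f g = begin
  sumFin (λ a → f a + g a)  ≡⟨ sumFin≡sum (λ a → f a + g a) ⟩
  sum (λ a → f a + g a)     ≡⟨ ∑-distrib-+ f g ⟩
  sum f + sum g             ≡⟨ cong₂ _+_ (sumFin≡sum f) (sumFin≡sum g) ⟨
  sumFin f + sumFin g       ∎
  where open ≡-Reasoning

sumFin-*ʳ : ∀ {n} c (f : Fin n → ℕ) → sumFin (λ a → f a * c) ≡ sumFin f * c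
sumFin-*ʳ c f = begin
  sumFin (λ a → f a * c)  ≡⟨ sumFin≡sum (λ a → f a * c) ⟩
  sum (λ a → f a * c)     ≡⟨ *-distribʳ-sum c f ⟨
  sum f * c               ≡⟨ cong (_* c) (sumFin≡sum f) ⟨
  sumFin f * c            ∎
  where open ≡-Reasoning

sumFin-mono-≤ : ∀ {n} {f g : Fin n → ℕ} → (∀ a → f a ≤ g a) → sumFin f ≤ sumFin g
sumFin-mono-≤ {zero}  _   = z≤n
sumFin-mono-≤ {suc n} f≤g = +-mono-≤ (f≤g zero) (sumFin-mono-≤ (f≤g ∘ suc))

≤∧sumFin≡⇒≗ : ∀ {n} {f g : Fin n → ℕ} → (∀ a → f a ≤ g a) → sumFin f ≡ sumFin g → f ≗ g
≤∧sumFin≡⇒≗ {suc n} {f} {g} f≤g Σf≡Σg = pointwise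
  where
  head≡ : f zero ≡ g zero
  head≡ = ≤-antisym (f≤g zero) (+-cancelʳ-≤ (sumFin (f ∘ suc)) _ _
    (≤-trans (+-monoʳ-≤ (g zero) (sumFin-mono-≤ (f≤g ∘ suc))) (≤-reflexive (sym Σf≡Σg))))
  pointwise : f ≗ g
  pointwise zero    = head≡
  pointwise (suc a) = ≤∧sumFin≡⇒≗ (f≤g ∘ suc)
    (+-cancelˡ-≡ (f zero) _ _ (trans Σf≡Σg (cong (_+ _) (sym head≡)))) a

sumFin₂ : ∀ {m n} → (Fin m → Fin n → ℕ) → ℕ
sumFin₂ f = sumFin (λ a → sumFin (f a))

≤∧sumFin₂≡⇒≡ : ∀ {m n} {f g : Fin m → Fin n → ℕ} →
  (∀ a b → f a b ≤ g a b) → sumFin₂ f ≡ sumFin₂ g → ∀ a b → f a b ≡ g a b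
≤∧sumFin₂≡⇒≡ f≤g Σf≡Σg a = ≤∧sumFin≡⇒≗ (f≤g a) (≤∧sumFin≡⇒≗ (sumFin-mono-≤ ∘ f≤g) Σf≡Σg a)

count₂≡sumFin₂ : ∀ {m n} (p : Fin m → Fin n → Bool) → count₂ p ≡ sumFin₂ (λ a b → 𝟙 (p a b))
count₂≡sumFin₂ p = sumFin-cong (count≡sumFin ∘ p)

count₂-comm : ∀ {m n} (p : Fin m → Fin n → Bool) → count₂ p ≡ count₂ (λ b a → p a b)
count₂-comm p = begin
  count₂ p                     ≡⟨ count₂≡sumFin₂ p ⟩
  sumFin₂ (λ a b → 𝟙 (p a b))  ≡⟨ sumFin-comm (λ a b → 𝟙 (p a b)) ⟩
  sumFin₂ (λ b a → 𝟙 (p a b))  ≡⟨ count₂≡sumFin₂ (λ b a → p a b) ⟨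
  count₂ (λ b a → p a b)       ∎
  where open ≡-Reasoning

sumFin-syntax : ∀ n → (Fin n → ℕ) → ℕ
sumFin-syntax _ = sumFin

infix 5 sumFin-syntax
syntax sumFin-syntax n (λ a → e) = Σ[ a < n ] e

sumFin₂-interchange : ∀ {m n} (f : Fin m → Fin m → Fin n → Fin n → ℕ) →
  sumFin₂ (λ i i' → sumFin₂ (f i i')) ≡ sumFin₂ (λ c c' → sumFin₂ (λ i i' → f i i' c c'))
sumFin₂-interchange {m} {n} f = begin
  Σ[ i < m ] Σ[ i' < m ] Σ[ c < n ] Σ[ c' < n ] f i i' c c'
    ≡⟨ sumFin-cong (λ i → sumFin-comm (λ i' c → Σ[ c' < n ] f i i' c c')) ⟩
  Σ[ i < m ] Σ[ c < n ] Σ[ i' < m ] Σ[ c' < n ] f i i' c c'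
    ≡⟨ sumFin-comm (λ i c → Σ[ i' < m ] Σ[ c' < n ] f i i' c c') ⟩
  Σ[ c < n ] Σ[ i < m ] Σ[ i' < m ] Σ[ c' < n ] f i i' c c'
    ≡⟨ sumFin-cong (λ c → sumFin-cong (λ i → sumFin-comm (λ i' c' → f i i' c c'))) ⟩
  Σ[ c < n ] Σ[ i < m ] Σ[ c' < n ] Σ[ i' < m ] f i i' c c'
    ≡⟨ sumFin-cong (λ c → sumFin-comm (λ i c' → Σ[ i' < m ] f i i' c c')) ⟩
  Σ[ c < n ] Σ[ c' < n ] Σ[ i < m ] Σ[ i' < m ] f i i' c c'
    ∎
  where open ≡-Reasoning

count₂-interchange : ∀ {m n} (p : Fin m → Fin m → Fin n → Fin n → Bool) →
  sumFin₂ (λ i i' → count₂ (p i i')) ≡ sumFin₂ (λ c c' → count₂ (λ i i' → p i i' c c'))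
count₂-interchange p = begin
  sumFin₂ (λ i i' → count₂ (p i i'))
    ≡⟨ sumFin-cong (λ i → sumFin-cong (λ i' → count₂≡sumFin₂ (p i i'))) ⟩
  sumFin₂ (λ i i' → sumFin₂ (λ c c' → 𝟙 (p i i' c c')))
    ≡⟨ sumFin₂-interchange (λ i i' c c' → 𝟙 (p i i' c c')) ⟩
  sumFin₂ (λ c c' → sumFin₂ (λ i i' → 𝟙 (p i i' c c')))
    ≡⟨ sumFin-cong (λ c → sumFin-cong (λ c' → count₂≡sumFin₂ (λ i i' → p i i' c c'))) ⟨
  sumFin₂ (λ c c' → count₂ (λ i i' → p i i' c c'))
    ∎
  where open ≡-Reasoning

-- Counting over Fin (m * n) ≅ Fin m × Fin n

count-↑ : ∀ {a b} (p : Fin (a + b) → Bool) →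
  count p ≡ count (λ i → p (i ↑ˡ b)) + count (λ j → p (a ↑ʳ j))
count-↑ {zero}      p = refl
count-↑ {suc a} {b} p =
  trans (cong (_+_ (𝟙 (p zero))) (count-↑ {a} {b} (p ∘ suc))) (sym (+-assoc (𝟙 (p zero)) _ _))

count-combine : ∀ {m n} (p : Fin (m * n) → Bool) →
  count p ≡ sumFin {m} (λ i → count {n} (λ j → p (combine i j)))
count-combine {zero}      p = refl
count-combine {suc m} {n} p = trans (count-↑ {n} {m * n} p)
  (cong (_+_ (count (λ j → p (j ↑ˡ (m * n))))) (count-combine {m} {n} (p ∘ (n ↑ʳ_))))

count-remQuot : ∀ {m n} (q : Fin m → Fin n → Bool) →
  count (λ β → uncurry q (remQuot n β)) ≡ count₂ q
count-remQuot {m} {n} q = trans (count-combine {m} {n} _)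
  (sumFin-cong (λ i → count-cong (λ j → cong (uncurry q) (remQuot-combine i j))))

remQuot-injective : ∀ m n {β β' : Fin (m * n)} → remQuot {m} n β ≡ remQuot n β' → β ≡ β'
remQuot-injective m n {β} {β'} eq = trans (sym (combine-remQuot {m} n β))
  (trans (cong (uncurry combine) eq) (combine-remQuot {m} n β'))

sumFin-δ : ∀ {n} (a : Fin n) (h : Fin n → ℕ) → sumFin (λ g → 𝟙 ⌊ a ≟ g ⌋ * h g) ≡ h a
sumFin-δ {suc n} zero    h = trans
  (cong₂ _+_ (+-identityʳ (h zero)) (trans (sumFin-const {n} 0) (*-zeroʳ n)))
  (+-identityʳ (h zero))
sumFin-δ {suc n} (suc a) h = trans
  (sumFin-cong (λ g → cong (λ b → 𝟙 b * h (suc g)) (⌊⌋-map′ (cong suc) suc-injective (a ≟ g))))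
  (sumFin-δ a (h ∘ suc))

fibre : ∀ {m s} → (Fin m → Fin s) → Fin s → ℕ
fibre u g = count (λ a → ⌊ u a ≟ g ⌋)

sumFin-fibres : ∀ {m s} (u : Fin m → Fin s) (h : Fin s → ℕ) →
  sumFin (λ a → h (u a)) ≡ sumFin (λ g → fibre u g * h g)
sumFin-fibres u h = begin
  sumFin (λ a → h (u a))
    ≡⟨ sumFin-cong (λ a → sumFin-δ (u a) h) ⟨
  sumFin (λ a → sumFin (λ g → 𝟙 ⌊ u a ≟ g ⌋ * h g))
    ≡⟨ sumFin-comm (λ a g → 𝟙 ⌊ u a ≟ g ⌋ * h g) ⟩
  sumFin (λ g → sumFin (λ a → 𝟙 ⌊ u a ≟ g ⌋ * h g))
    ≡⟨ sumFin-cong (λ g → sumFin-*ʳ (h g) (λ a → 𝟙 ⌊ u a ≟ g ⌋)) ⟩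
  sumFin (λ g → sumFin (λ a → 𝟙 ⌊ u a ≟ g ⌋) * h g)
    ≡⟨ sumFin-cong (λ g → cong (_* h g) (count≡sumFin (λ a → ⌊ u a ≟ g ⌋))) ⟨
  sumFin (λ g → fibre u g * h g)
    ∎
  where open ≡-Reasoning

sumFin-fibre : ∀ {m s} (u : Fin m → Fin s) → sumFin (fibre u) ≡ m
sumFin-fibre {m} u = begin
  sumFin (fibre u)              ≡⟨ sumFin-cong (λ g → *-identityʳ (fibre u g)) ⟨
  sumFin (λ g → fibre u g * 1)  ≡⟨ sumFin-fibres u (λ _ → 1) ⟨
  sumFin {m} (λ _ → 1)          ≡⟨ sumFin-const {m} 1 ⟩
  m * 1                         ≡⟨ *-identityʳ m ⟩
  m                             ∎
  where open ≡-Reasoning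

count₂-collisions : ∀ {m s} (u : Fin m → Fin s) →
  count₂ (λ a b → ⌊ u a ≟ u b ⌋) ≡ sumFin (λ g → fibre u g * fibre u g)
count₂-collisions u = trans
  (sumFin-cong (λ a → count-cong (λ b → ⌊⌋-⇔ (mk⇔ sym sym) (u a ≟ u b) (u b ≟ u a))))
  (sumFin-fibres u (fibre u))

-- The sum-of-squares inequality

-- 2 x n + d² = n² + x² with d = |n - x|.
am-gm-gap : ∀ n x → ∃ λ d → n * (2 * x) + d * d ≡ n * n + x * x × (d ≡ 0 → n ≡ x)
am-gm-gap n x with ≤-total n x
... | inj₁ n≤x with d , refl ← m≤n⇒∃[o]m+o≡n n≤x =
  d , ℕ-solve (n ∷ d ∷ []) , λ { refl → sym (+-identityʳ n) }
... | inj₂ x≤n with d , refl ← m≤n⇒∃[o]m+o≡n x≤n =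
  d , ℕ-solve (x ∷ d ∷ []) , λ { refl → +-identityʳ x }

am-gm : ∀ n x → n * (2 * x) ≤ n * n + x * x
am-gm n x with d , gap , _ ← am-gm-gap n x = ≤-trans (m≤m+n _ (d * d)) (≤-reflexive gap)

am-gm-≡ : ∀ n x → n * (2 * x) ≡ n * n + x * x → n ≡ x
am-gm-≡ n x tight with d , gap , d≡0⇒n≡x ← am-gm-gap n x =
  d≡0⇒n≡x ([ id , id ]′ (m*n≡0⇒m≡0∨n≡0 d d²≡0))
  where
  d²≡0 : d * d ≡ 0
  d²≡0 = +-cancelˡ-≡ (n * (2 * x)) _ _ (trans gap (trans (sym tight) (sym (+-identityʳ _))))

module SumOfSquares {s : ℕ} (x : ℕ) (N : Fin s → ℕ) (ΣN≡sx : sumFin N ≡ s * x) where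

  private
    Σ2xN : sumFin (λ g → N g * (2 * x)) ≡ s * (x * x) + s * (x * x)
    Σ2xN = trans (sumFin-*ʳ (2 * x) N) (trans (cong (_* (2 * x)) ΣN≡sx) (ℕ-solve (s ∷ x ∷ [])))

    ΣN²+x² : sumFin (λ g → N g * N g + x * x) ≡ sumFin (λ g → N g * N g) + s * (x * x)
    ΣN²+x² = trans (sumFin-+ (λ g → N g * N g) (λ _ → x * x))
                   (cong (_+_ (sumFin (λ g → N g * N g))) (sumFin-const {s} (x * x)))

  sumFin-squares-≥ : s * (x * x) ≤ sumFin (λ g → N g * N g)
  sumFin-squares-≥ = +-cancelʳ-≤ (s * (x * x)) _ _ (≤-trans (≤-reflexive (sym Σ2xN))
    (≤-trans (sumFin-mono-≤ (λ g → am-gm (N g) x)) (≤-reflexive ΣN²+x²)))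

  sumFin-squares-≡ : sumFin (λ g → N g * N g) ≡ s * (x * x) → ∀ g → N g ≡ x
  sumFin-squares-≡ tight g = am-gm-≡ (N g) x (≤∧sumFin≡⇒≗ (λ g → am-gm (N g) x)
    (trans Σ2xN (sym (trans ΣN²+x² (cong (_+ s * (x * x)) tight)))) g)

∣∧<⇒≡0 : ∀ {m n} → m ℕ∣ n → n < m → n ≡ 0
∣∧<⇒≡0 {n = zero}  _   _   = refl
∣∧<⇒≡0 {n = suc n} m∣n n<m = contradiction m∣n (>⇒∤ n<m)

-- ℤ_s is Fin s; computations are done in ℤ up to congruence modulo s.
module Residues (s : ℕ) .{{_ : NonZero s}} where

  ⟦_⟧ : Fin s → ℤ
  ⟦ a ⟧ = + toℕ a

  infix 4 _≋_ _≋?_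

  -- A record rather than a definition, so that a and b stay inferable.
  record _≋_ (a b : ℤ) : Set where
    constructor ∣⇒≋
    field ≋⇒∣ : + s ∣ a - b
  open _≋_

  _≋?_ : (a b : ℤ) → Dec (a ≋ b)
  a ≋? b = map′ ∣⇒≋ ≋⇒∣ (+ s ∣? a - b)

  ≋-refl : ∀ {a} → a ≋ a
  ≋-refl {a} = ∣⇒≋ (divides (+ 0) (ℤ.+-inverseʳ a))

  ≋-sym : ∀ {a b} → a ≋ b → b ≋ a
  ≋-sym {a} {b} (∣⇒≋ s∣a-b) = ∣⇒≋ (subst (+ s ∣_) (-[a-b]≡b-a a b) (∣m⇒∣-m s∣a-b))
    where -[a-b]≡b-a : ∀ a b → - (a - b) ≡ b - a
          -[a-b]≡b-a = ℤ-solve-∀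

  ≋-trans : ∀ {a b c} → a ≋ b → b ≋ c → a ≋ c
  ≋-trans {a} {b} {c} (∣⇒≋ s∣a-b) (∣⇒≋ s∣b-c) =
    ∣⇒≋ (subst (+ s ∣_) ([a-b]+[b-c]≡a-c a b c) (∣m∣n⇒∣m+n s∣a-b s∣b-c))
    where [a-b]+[b-c]≡a-c : ∀ a b c → (a - b) ℤ.+ (b - c) ≡ a - c
          [a-b]+[b-c]≡a-c = ℤ-solve-∀

  ≋-sym⇔ : ∀ {a b} → (a ≋ b) ⇔ (b ≋ a)
  ≋-sym⇔ = mk⇔ ≋-sym ≋-sym

  ≋-respˡ : ∀ {a a' b} → a ≋ a' → (a ≋ b) ⇔ (a' ≋ b)
  ≋-respˡ a≋a' = mk⇔ (≋-trans (≋-sym a≋a')) (≋-trans a≋a')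

  ≋⇔≋ : ∀ {a b c d} → a - b ≡ c - d → (a ≋ b) ⇔ (c ≋ d)
  ≋⇔≋ eq = mk⇔ (λ (∣⇒≋ p) → ∣⇒≋ (subst (+ s ∣_) eq p))
               (λ (∣⇒≋ p) → ∣⇒≋ (subst (+ s ∣_) (sym eq) p))

  private
    ≤-≋⇒≡ : ∀ {a b : Fin s} → toℕ a ≤ toℕ b → ⟦ a ⟧ ≋ ⟦ b ⟧ → a ≡ b
    ≤-≋⇒≡ {a} {b} a≤b (∣⇒≋ s∣a-b) =
      toℕ-injective (≤-antisym a≤b (m∸n≡0⇒m≤n (∣∧<⇒≡0 s∣b-a b-a<s)))
      where
      s∣b-a : s ℕ∣ toℕ b ∸ toℕ a
      s∣b-a = subst (s ℕ∣_) (trans (cong ℤ.∣_∣ (ℤ.[+m]-[+n]≡m⊖n (toℕ a) (toℕ b))) (ℤ.∣⊖∣-≤ a≤b))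
                    (∣⇒∣ᵤ s∣a-b)
      b-a<s : toℕ b ∸ toℕ a < s
      b-a<s = ≤-<-trans (m∸n≤m (toℕ b) (toℕ a)) (toℕ<n b)

  ⟦⟧-injective : ∀ {a b : Fin s} → ⟦ a ⟧ ≋ ⟦ b ⟧ → a ≡ b
  ⟦⟧-injective {a} {b} a≋b with ≤-total (toℕ a) (toℕ b)
  ... | inj₁ a≤b = ≤-≋⇒≡ a≤b a≋b
  ... | inj₂ b≤a = sym (≤-≋⇒≡ b≤a (≋-sym a≋b))

  ⟦⟧-≋⇔≡ : ∀ {a b : Fin s} → (⟦ a ⟧ ≋ ⟦ b ⟧) ⇔ (a ≡ b)
  ⟦⟧-≋⇔≡ = mk⇔ ⟦⟧-injective (λ { refl → ≋-refl })

  ≋-+-cancel⇔ : ∀ {a b : Fin s} z → (⟦ a ⟧ ℤ.+ z ≋ ⟦ b ⟧ ℤ.+ z) ⇔ (a ≡ b)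
  ≋-+-cancel⇔ {a} {b} z = ⇔.trans (≋⇔≋ (a+z-[b+z]≡a-b ⟦ a ⟧ ⟦ b ⟧ z)) ⟦⟧-≋⇔≡
    where a+z-[b+z]≡a-b : ∀ a b z → (a ℤ.+ z) - (b ℤ.+ z) ≡ a - b
          a+z-[b+z]≡a-b = ℤ-solve-∀

  ≋-offset⇔ : ∀ {y z} (a b : Fin s) → y ≡ z → (y ≋ (⟦ a ⟧ - ⟦ b ⟧) ℤ.+ z) ⇔ (a ≡ b)
  ≋-offset⇔ {y} a b refl =
    ⇔.trans (≋⇔≋ (y-[a-b+y]≡b-a y ⟦ a ⟧ ⟦ b ⟧)) (⇔.trans ⟦⟧-≋⇔≡ (mk⇔ sym sym))
    where y-[a-b+y]≡b-a : ∀ y a b → y - ((a - b) ℤ.+ y) ≡ b - a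
          y-[a-b+y]≡b-a = ℤ-solve-∀

  fromℤ : ℤ → Fin s
  fromℤ z = fromℕ< (n%ℕd<d z s)

  ⟦fromℤ⟧ : ∀ z → ⟦ fromℤ z ⟧ ≋ z
  ⟦fromℤ⟧ z = ∣⇒≋ (divides (- q) (begin
    ⟦ fromℤ z ⟧ - z             ≡⟨ cong₂ _-_ (cong +_ (toℕ-fromℕ< _)) (a≡a%ℕn+[a/ℕn]*n z s) ⟩
    + r - (+ r ℤ.+ q ℤ.* + s)   ≡⟨ r-[r+qs]≡-q*s (+ r) q (+ s) ⟩
    - q ℤ.* + s                 ∎))
    where
    open ≡-Reasoning
    r = z ℤ.%ℕ s
    q = z ℤ./ℕ s
    r-[r+qs]≡-q*s : ∀ r q s → r - (r ℤ.+ q ℤ.* s) ≡ - q ℤ.* s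
    r-[r+qs]≡-q*s = ℤ-solve-∀

  ⟦zsub⟧ : ∀ a b → ⟦ zsub a b ⟧ ≋ ⟦ a ⟧ - ⟦ b ⟧
  ⟦zsub⟧ a b = subst (λ c → ⟦ c ⟧ ≋ ⟦ a ⟧ - ⟦ b ⟧) (sym zsub≡fromℤ)
                     (≋-trans (⟦fromℤ⟧ (+ n)) n≋a-b)
    where
    n = toℕ a + (s ∸ toℕ b)
    zsub≡fromℤ : zsub a b ≡ fromℤ (+ n)
    zsub≡fromℤ = toℕ-injective (trans (toℕ-fromℕ< _) (sym (toℕ-fromℕ< _)))
    s-b : + (s ∸ toℕ b) ≡ + s - ⟦ b ⟧
    s-b = sym (trans (ℤ.[+m]-[+n]≡m⊖n s (toℕ b)) (ℤ.⊖-≥ (<⇒≤ (toℕ<n b))))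
    n≋a-b : + n ≋ ⟦ a ⟧ - ⟦ b ⟧
    n≋a-b = ∣⇒≋ (divides (+ 1) (begin
      + n - (⟦ a ⟧ - ⟦ b ⟧)
        ≡⟨ cong (_- (⟦ a ⟧ - ⟦ b ⟧)) (trans (ℤ.pos-+ (toℕ a) _) (cong (ℤ._+_ ⟦ a ⟧) s-b)) ⟩
      ⟦ a ⟧ ℤ.+ (+ s - ⟦ b ⟧) - (⟦ a ⟧ - ⟦ b ⟧)
        ≡⟨ a+[s-b]-[a-b]≡s ⟦ a ⟧ ⟦ b ⟧ (+ s) ⟩
      + 1 ℤ.* + s
        ∎))
      where
      open ≡-Reasoning
      a+[s-b]-[a-b]≡s : ∀ a b s → a ℤ.+ (s - b) - (a - b) ≡ + 1 ℤ.* s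
      a+[s-b]-[a-b]≡s = ℤ-solve-∀

  ≡fromℤ⇔ : ∀ {a z} → (a ≡ fromℤ z) ⇔ (⟦ a ⟧ ≋ z)
  ≡fromℤ⇔ {z = z} = mk⇔ (λ { refl → ⟦fromℤ⟧ z })
                        (λ a≋z → ⟦⟧-injective (≋-trans a≋z (≋-sym (⟦fromℤ⟧ z))))

  zsub≡fromℤ⇔ : ∀ a b z → (zsub a b ≡ fromℤ z) ⇔ (⟦ a ⟧ - ⟦ b ⟧ ≋ z)
  zsub≡fromℤ⇔ a b z = ⇔.trans ≡fromℤ⇔ (≋-respˡ (⟦zsub⟧ a b))

  zsub≡zsub⇔ : ∀ a b c d → (zsub a b ≡ zsub c d) ⇔ (⟦ a ⟧ - ⟦ b ⟧ ≋ ⟦ c ⟧ - ⟦ d ⟧)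
  zsub≡zsub⇔ a b c d = mk⇔
    (λ eq → ≋-trans (≋-sym (⟦zsub⟧ a b))
                    (subst (λ e → ⟦ e ⟧ ≋ ⟦ c ⟧ - ⟦ d ⟧) (sym eq) (⟦zsub⟧ c d)))
    (λ a-b≋c-d → ⟦⟧-injective (≋-trans (⟦zsub⟧ a b) (≋-trans a-b≋c-d (≋-sym (⟦zsub⟧ c d)))))

  count-≋-∧ : ∀ z (q : Fin s → Bool) → count (λ a → ⌊ ⟦ a ⟧ ≋? z ⌋ ∧ q a) ≡ 𝟙 (q (fromℤ z))
  count-≋-∧ z q = trans
    (count-cong (λ a → cong (_∧ q a) (⌊⌋-⇔ (⇔.sym ≡fromℤ⇔) (⟦ a ⟧ ≋? z) (a ≟ fromℤ z))))
    (count-≡-∧ (fromℤ z) q)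

  count-≋ : ∀ z → count (λ a → ⌊ ⟦ a ⟧ ≋? z ⌋) ≡ 1
  count-≋ z = trans (count-cong (λ a → sym (∧-identityʳ ⌊ ⟦ a ⟧ ≋? z ⌋)))
                    (count-≋-∧ z (λ _ → true))

  count-≋-≋ : ∀ z z' → count (λ a → ⌊ ⟦ a ⟧ ≋? z ⌋ ∧ ⌊ ⟦ a ⟧ ≋? z' ⌋) ≡ 𝟙 ⌊ z ≋? z' ⌋
  count-≋-≋ z z' = trans (count-≋-∧ z (λ a → ⌊ ⟦ a ⟧ ≋? z' ⌋))
    (cong 𝟙 (⌊⌋-⇔ (≋-respˡ (⟦fromℤ⟧ z)) (⟦ fromℤ z ⟧ ≋? z') (z ≋? z')))

module DifferenceSchemes (s : ℕ) .{{_ : NonZero s}} where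

  open Residues s

  IsDifferenceScheme : ∀ {m n} → ℕ → (Fin m → Fin n → Fin s) → Set
  IsDifferenceScheme x D =
    ∀ c c' → c ≢ c' → ∀ g → count (λ i → ⌊ zsub (D i c) (D i c') ≟ g ⌋) ≡ x

  transpose : ∀ {m n} → (Fin m → Fin n → Fin s) → Fin n → Fin m → Fin s
  transpose D c i = D i c

  count-difference-≋ : ∀ {m n x} {D : Fin m → Fin n → Fin s} → IsDifferenceScheme x D →
    ∀ {c c'} → c ≢ c' → ∀ z → count (λ i → ⌊ ⟦ D i c ⟧ - ⟦ D i c' ⟧ ≋? z ⌋) ≡ x
  count-difference-≋ {D = D} ds {c} {c'} c≢c' z = trans
    (count-cong (λ i → ⌊⌋-⇔ (⇔.sym (zsub≡fromℤ⇔ (D i c) (D i c') z))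
                            (⟦ D i c ⟧ - ⟦ D i c' ⟧ ≋? z) (zsub (D i c) (D i c') ≟ fromℤ z)))
    (ds c c' c≢c' (fromℤ z))

  module _ {x m : ℕ} (m≡sx : m ≡ s * x) (D : Fin m → Fin m → Fin s)
           (ds : IsDifferenceScheme x D) where

    private
      row-diff column-diff : Fin m → Fin m → Fin m → Fin s
      row-diff    i i' c = zsub (D i c) (D i' c)
      column-diff c c' i = zsub (D i c) (D i c')

      agree : Fin m → Fin m → Fin m → Fin m → Bool
      agree i i' c c' = ⌊ row-diff i i' c ≟ row-diff i i' c' ⌋

      agree-transpose : ∀ i i' c c' → agree i i' c c' ≡ ⌊ column-diff c c' i ≟ column-diff c c' i' ⌋
      agree-transpose i i' c c' = ⌊⌋-⇔
        (⇔.trans (zsub≡zsub⇔ a b a' b')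
          (⇔.trans (≋⇔≋ (swap ⟦ a ⟧ ⟦ b ⟧ ⟦ a' ⟧ ⟦ b' ⟧)) (⇔.sym (zsub≡zsub⇔ a a' b b'))))
        (zsub a b ≟ zsub a' b') (zsub a a' ≟ zsub b b')
        where
        a = D i c ; b = D i' c ; a' = D i c' ; b' = D i' c'
        swap : ∀ a b c d → (a - b) - (c - d) ≡ (a - c) - (b - d)
        swap = ℤ-solve-∀

      agree-diagonal : ∀ i c c' → agree i i c c' ≡ true
      agree-diagonal i c c' = ⌊⌋-true (row-diff i i c ≟ row-diff i i c')
        (Equivalence.from (zsub≡zsub⇔ (D i c) (D i c) (D i c') (D i c'))
          (subst₂ _≋_ (sym (ℤ.+-inverseʳ ⟦ D i c ⟧)) (sym (ℤ.+-inverseʳ ⟦ D i c' ⟧)) ≋-refl))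

      bound : Fin m → Fin m → ℕ
      bound a b = if ⌊ a ≟ b ⌋ then m * m else s * (x * x)

      bound-off-diagonal : ∀ {a b} → a ≢ b → bound a b ≡ s * (x * x)
      bound-off-diagonal {a} {b} a≢b =
        cong (if_then m * m else s * (x * x)) (⌊⌋-false (a ≟ b) a≢b)

      count₂-true : count₂ {m} {m} (λ _ _ → true) ≡ m * m
      count₂-true = trans (sumFin-cong {m} (λ _ → count-true {m})) (sumFin-const {m} m)

      column-agreements : ∀ c c' → count₂ (λ i i' → agree i i' c c') ≡ bound c c'
      column-agreements c c' with c ≟ c'
      ... | yes refl = trans
        (sumFin-cong (λ i → count-cong (λ i' → ⌊⌋-true (row-diff i i' c ≟ row-diff i i' c) refl)))
        count₂-true
      ... | no c≢c' = begin
        count₂ (λ i i' → agree i i' c c')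
          ≡⟨ sumFin-cong (λ i → count-cong (λ i' → agree-transpose i i' c c')) ⟩
        count₂ (λ i i' → ⌊ column-diff c c' i ≟ column-diff c c' i' ⌋)
          ≡⟨ count₂-collisions (column-diff c c') ⟩
        sumFin (λ g → fibre (column-diff c c') g * fibre (column-diff c c') g)
          ≡⟨ sumFin-cong (λ g → cong₂ _*_ (ds c c' c≢c' g) (ds c c' c≢c' g)) ⟩
        sumFin {s} (λ _ → x * x)
          ≡⟨ sumFin-const {s} (x * x) ⟩
        s * (x * x)
          ∎
        where open ≡-Reasoning

      row-agreements-≥ : ∀ i i' → bound i i' ≤ count₂ (λ c c' → agree i i' c c')
      row-agreements-≥ i i' with i ≟ i'
      ... | yes refl = ≤-reflexive (sym (trans
        (sumFin-cong (λ c → count-cong (λ c' → agree-diagonal i c c'))) count₂-true))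
      ... | no _     =
        subst (s * (x * x) ≤_) (sym (count₂-collisions (row-diff i i'))) sumFin-squares-≥
        where open SumOfSquares x (fibre (row-diff i i')) (trans (sumFin-fibre (row-diff i i')) m≡sx)

      row-agreements : ∀ i i' → count₂ (λ c c' → agree i i' c c') ≡ bound i i'
      row-agreements i i' = sym (≤∧sumFin₂≡⇒≡ row-agreements-≥ (begin
        sumFin₂ bound
          ≡⟨ sumFin-cong (λ c → sumFin-cong (column-agreements c)) ⟨
        sumFin₂ (λ c c' → count₂ (λ i i' → agree i i' c c'))
          ≡⟨ count₂-interchange (λ c c' i i' → agree i i' c c') ⟩
        sumFin₂ (λ i i' → count₂ (λ c c' → agree i i' c c'))
          ∎) i i')
        where open ≡-Reasoning

    transpose-isDifferenceScheme : IsDifferenceScheme x (transpose D)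
    transpose-isDifferenceScheme i i' i≢i' = sumFin-squares-≡ (begin
      sumFin (λ g → fibre (row-diff i i') g * fibre (row-diff i i') g)
        ≡⟨ count₂-collisions (row-diff i i') ⟨
      count₂ (λ c c' → agree i i' c c')
        ≡⟨ row-agreements i i' ⟩
      bound i i'
        ≡⟨ bound-off-diagonal i≢i' ⟩
      s * (x * x)
        ∎)
      where
      open ≡-Reasoning
      open SumOfSquares x (fibre (row-diff i i')) (trans (sumFin-fibre (row-diff i i')) m≡sx)

-- Array rows are indexed by the columns c of D, resolution classes by the rows 1+ρ of D, and
-- block β corresponds to (g , ρ) = remQuot t β.
module Construction {s t x : ℕ} .{{_ : NonZero s}} (D : Fin (suc t) → Fin (suc t) → Fin s)
  (columns : DifferenceSchemes.IsDifferenceScheme s x D)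
  (rows : DifferenceSchemes.IsDifferenceScheme s x (DifferenceSchemes.transpose s D)) where

  open Residues s
  open DifferenceSchemes s using (count-difference-≋)

  δ : Fin t → Fin (suc t) → ℤ
  δ ρ c = ⟦ D (suc ρ) c ⟧ - ⟦ D zero c ⟧

  incidence : Fin (suc t) → Fin s → Fin s → Fin t → Bool
  incidence c j g ρ = ⌊ ⟦ j ⟧ ≋? ⟦ g ⟧ ℤ.+ δ ρ c ⌋

  N : Fin (suc t) → Fin s → Fin (s * t) → Bool
  N c j β = uncurry (incidence c j) (remQuot {s} t β)

  offset : Fin (s * t) → Fin s
  offset β = proj₁ (remQuot {s} t β)

  class : Fin (s * t) → Fin t
  class β = proj₂ (remQuot {s} t β)

  incidence-by-offset : ∀ c j g ρ → incidence c j g ρ ≡ ⌊ ⟦ g ⟧ ≋? ⟦ j ⟧ - δ ρ c ⌋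
  incidence-by-offset c j g ρ = ⌊⌋-⇔
    (⇔.trans ≋-sym⇔ (≋⇔≋ (g+d-j≡g-[j-d] ⟦ g ⟧ (δ ρ c) ⟦ j ⟧)))
    (⟦ j ⟧ ≋? ⟦ g ⟧ ℤ.+ δ ρ c) (⟦ g ⟧ ≋? ⟦ j ⟧ - δ ρ c)
    where g+d-j≡g-[j-d] : ∀ g d j → (g ℤ.+ d) - j ≡ g - (j - d)
          g+d-j≡g-[j-d] = ℤ-solve-∀

  block-meets-row : ∀ c g ρ → count (λ j → incidence c j g ρ) ≡ 1
  block-meets-row c g ρ = count-≋ (⟦ g ⟧ ℤ.+ δ ρ c)

  class-covers-treatment : ∀ c j ρ → count (λ g → incidence c j g ρ) ≡ 1
  class-covers-treatment c j ρ =
    trans (count-cong (λ g → incidence-by-offset c j g ρ)) (count-≋ (⟦ j ⟧ - δ ρ c))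

  -- A block of class ρ contains both (c , j) and (c' , j') iff row i = 1+ρ satisfies this.
  pair-condition : Fin (suc t) → Fin (suc t) → Fin s → Fin s → Fin (suc t) → Bool
  pair-condition c c' j j' i =
    ⌊ ⟦ D i c ⟧ - ⟦ D i c' ⟧ ≋? (⟦ j ⟧ - ⟦ j' ⟧) ℤ.+ (⟦ D zero c ⟧ - ⟦ D zero c' ⟧) ⌋

  pair-count : ∀ c c' j j' →
    count (λ β → N c j β ∧ N c' j' β) ≡ count (pair-condition c c' j j' ∘ suc)
  pair-count c c' j j' = begin
    count (λ β → N c j β ∧ N c' j' β)
      ≡⟨ count-remQuot {s} {t} (λ g ρ → incidence c j g ρ ∧ incidence c' j' g ρ) ⟩
    count₂ (λ g ρ → incidence c j g ρ ∧ incidence c' j' g ρ)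
      ≡⟨ count₂-comm (λ g ρ → incidence c j g ρ ∧ incidence c' j' g ρ) ⟩
    count₂ (λ ρ g → incidence c j g ρ ∧ incidence c' j' g ρ)
      ≡⟨ sumFin-cong (λ ρ → count-cong (λ g →
           cong₂ _∧_ (incidence-by-offset c j g ρ) (incidence-by-offset c' j' g ρ))) ⟩
    count₂ (λ ρ g → ⌊ ⟦ g ⟧ ≋? ⟦ j ⟧ - δ ρ c ⌋ ∧ ⌊ ⟦ g ⟧ ≋? ⟦ j' ⟧ - δ ρ c' ⌋)
      ≡⟨ sumFin-cong (λ ρ → count-≋-≋ (⟦ j ⟧ - δ ρ c) (⟦ j' ⟧ - δ ρ c')) ⟩
    sumFin (λ ρ → 𝟙 ⌊ ⟦ j ⟧ - δ ρ c ≋? ⟦ j' ⟧ - δ ρ c' ⌋)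
      ≡⟨ sumFin-cong (λ ρ → cong 𝟙 (⌊⌋-⇔ (⇔.trans (≋⇔≋ (rearrange ρ)) ≋-sym⇔) _ _)) ⟩
    sumFin (𝟙 ∘ pair-condition c c' j j' ∘ suc)
      ≡⟨ count≡sumFin (pair-condition c c' j j' ∘ suc) ⟨
    count (pair-condition c c' j j' ∘ suc)
      ∎
    where
    open ≡-Reasoning
    rearrange : ∀ ρ → (⟦ j ⟧ - δ ρ c) - (⟦ j' ⟧ - δ ρ c') ≡
      ((⟦ j ⟧ - ⟦ j' ⟧) ℤ.+ (⟦ D zero c ⟧ - ⟦ D zero c' ⟧)) - (⟦ D (suc ρ) c ⟧ - ⟦ D (suc ρ) c' ⟧)
    rearrange ρ = identity ⟦ j ⟧ ⟦ j' ⟧ ⟦ D (suc ρ) c ⟧ ⟦ D (suc ρ) c' ⟧ ⟦ D zero c ⟧ ⟦ D zero c' ⟧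
      where identity : ∀ j j' a a' b b' →
                       (j - (a - b)) - (j' - (a' - b')) ≡ ((j - j') ℤ.+ (b - b')) - (a - a')
            identity = ℤ-solve-∀

  -- Row 0 of D contributes to the column condition exactly when j = j'.
  pairs-in-distinct-rows : ∀ {c c'} → c ≢ c' → ∀ j j' →
    𝟙 ⌊ j ≟ j' ⌋ + count (λ β → N c j β ∧ N c' j' β) ≡ x
  pairs-in-distinct-rows {c} {c'} c≢c' j j' = trans
    (cong₂ _+_ (cong 𝟙 (⌊⌋-⇔ (⇔.sym (≋-offset⇔ j j' refl)) (j ≟ j') (_ ≋? _)))
               (pair-count c c' j j'))
    (count-difference-≋ {D = D} columns c≢c' ((⟦ j ⟧ - ⟦ j' ⟧) ℤ.+ (⟦ D zero c ⟧ - ⟦ D zero c' ⟧)))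

  pairs-in-row : ∀ c j j' → j ≢ j' → count (λ β → N c j β ∧ N c j' β) ≡ 0
  pairs-in-row c j j' j≢j' = trans (pair-count c c j j') (trans (count-cong never) (count-false {t}))
    where
    never : ∀ ρ → pair-condition c c j j' (suc ρ) ≡ false
    never ρ = trans
      (⌊⌋-⇔ (≋-offset⇔ j j' (trans (ℤ.+-inverseʳ ⟦ D (suc ρ) c ⟧) (sym (ℤ.+-inverseʳ ⟦ D zero c ⟧))))
            (_ ≋? _) (j ≟ j'))
      (⌊⌋-false (j ≟ j') j≢j')

  pairs-in-column : ∀ c c' j → c ≢ c' → count (λ β → N c j β ∧ N c' j β) ≡ x ∸ 1
  pairs-in-column c c' j c≢c' = cong (_∸ 1) (trans
    (cong (λ b → 𝟙 b + count (λ β → N c j β ∧ N c' j β)) (sym (⌊⌋-true (j ≟ j) refl)))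
    (pairs-in-distinct-rows c≢c' j j))

  pairs-elsewhere : ∀ c c' j j' → c ≢ c' → j ≢ j' → count (λ β → N c j β ∧ N c' j' β) ≡ x
  pairs-elsewhere c c' j j' c≢c' j≢j' = trans
    (cong (λ b → 𝟙 b + count (λ β → N c j β ∧ N c' j' β)) (sym (⌊⌋-false (j ≟ j') j≢j')))
    (pairs-in-distinct-rows c≢c' j j')

  block-size : ∀ β → count₂ (λ c j → N c j β) ≡ suc t
  block-size β = trans (sumFin-cong (λ c → block-meets-row c (offset β) (class β)))
                       (trans (sumFin-const {suc t} 1) (*-identityʳ (suc t)))

  replication : ∀ c j → count (λ β → N c j β) ≡ t
  replication c j = begin
    count (λ β → N c j β)               ≡⟨ count-remQuot {s} {t} (incidence c j) ⟩
    count₂ (incidence c j)              ≡⟨ count₂-comm (incidence c j) ⟩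
    count₂ (λ ρ g → incidence c j g ρ)  ≡⟨ sumFin-cong (class-covers-treatment c j) ⟩
    sumFin {t} (λ _ → 1)                ≡⟨ sumFin-const {t} 1 ⟩
    t * 1                               ≡⟨ *-identityʳ t ⟩
    t                                   ∎
    where open ≡-Reasoning

  design : RD (suc t) s (s * t) t (suc t) 0 (x ∸ 1) x
  design = record
    { N           = N
    ; blockSize   = block-size
    ; replication = replication
    ; sameRow     = pairs-in-row
    ; sameCol     = pairs-in-column
    ; other       = pairs-elsewhere
    }

  shared-in-row : Fin (s * t) → Fin (s * t) → Fin (suc t) → Bool
  shared-in-row β β' c = ⌊ ⟦ offset β ⟧ ℤ.+ δ (class β) c ≋? ⟦ offset β' ⟧ ℤ.+ δ (class β') c ⌋

  meet-count : ∀ β β' → meet design β β' ≡ count (shared-in-row β β')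
  meet-count β β' = trans
    (sumFin-cong (λ c → count-≋-≋ (⟦ offset β ⟧ ℤ.+ δ (class β) c) (⟦ offset β' ⟧ ℤ.+ δ (class β') c)))
    (sym (count≡sumFin (shared-in-row β β')))

  meet-within-class : ∀ β β' → β ≢ β' → class β ≡ class β' → meet design β β' ≡ 0
  meet-within-class β β' β≢β' same-class =
    trans (meet-count β β') (trans (count-cong disjoint) (count-false {suc t}))
    where
    offset≢ : offset β ≢ offset β'
    offset≢ same-offset = β≢β' (remQuot-injective s t (×-≡,≡→≡ (same-offset , same-class)))
    disjoint : ∀ c → shared-in-row β β' c ≡ false
    disjoint c rewrite same-class = trans
      (⌊⌋-⇔ (≋-+-cancel⇔ (δ (class β') c)) (_ ≋? _) (offset β ≟ offset β'))
      (⌊⌋-false (offset β ≟ offset β') offset≢)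

  meet-across-classes : ∀ β β' → class β ≢ class β' → meet design β β' ≡ x
  meet-across-classes β β' class≢ = begin
    meet design β β'
      ≡⟨ meet-count β β' ⟩
    count (shared-in-row β β')
      ≡⟨ count-cong {p = shared-in-row β β'} (λ c → ⌊⌋-⇔ (≋⇔≋ (rearrange c)) (_ ≋? _)
           (⟦ D (suc (class β)) c ⟧ - ⟦ D (suc (class β')) c ⟧ ≋? g' - g)) ⟩
    count (λ c → ⌊ ⟦ D (suc (class β)) c ⟧ - ⟦ D (suc (class β')) c ⟧ ≋? g' - g ⌋)
      ≡⟨ count-difference-≋ {D = DifferenceSchemes.transpose s D} rows
           (class≢ ∘ suc-injective) (g' - g) ⟩
    x
      ∎
    where
    open ≡-Reasoning
    g = ⟦ offset β ⟧ ; g' = ⟦ offset β' ⟧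
    rearrange : ∀ c → (g ℤ.+ δ (class β) c) - (g' ℤ.+ δ (class β') c) ≡
      (⟦ D (suc (class β)) c ⟧ - ⟦ D (suc (class β')) c ⟧) - (g' - g)
    rearrange c = identity g g' ⟦ D (suc (class β)) c ⟧ ⟦ D (suc (class β')) c ⟧ ⟦ D zero c ⟧
      where identity : ∀ g g' a a' b → (g ℤ.+ (a - b)) - (g' ℤ.+ (a' - b)) ≡ (a - a') - (g' - g)
            identity = ℤ-solve-∀

  resolution : IsResolution design class
  resolution γ c j = begin
    count (λ β → ⌊ class β ≟ γ ⌋ ∧ N c j β)
      ≡⟨ count-remQuot {s} {t} (λ g ρ → ⌊ ρ ≟ γ ⌋ ∧ incidence c j g ρ) ⟩
    count₂ (λ g ρ → ⌊ ρ ≟ γ ⌋ ∧ incidence c j g ρ)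
      ≡⟨ sumFin-cong (λ g → count-≡-∧ γ (incidence c j g)) ⟩
    sumFin (λ g → 𝟙 (incidence c j g γ))
      ≡⟨ count≡sumFin (λ g → incidence c j g γ) ⟨
    count (λ g → incidence c j g γ)
      ≡⟨ class-covers-treatment c j γ ⟩
    1
      ∎
    where open ≡-Reasoning

  class-size : ∀ γ → count (λ β → ⌊ class β ≟ γ ⌋) ≡ s
  class-size γ = trans (count-remQuot {s} {t} (λ _ ρ → ⌊ ρ ≟ γ ⌋))
    (trans (sumFin-cong {s} (λ _ → count-≡ γ)) (trans (sumFin-const {s} 1) (*-identityʳ s)))

  affine : AffineResolvable design 0 x
  affine = t , class , resolution , meet-within-class , meet-across-classes

  std : STD design
  std = t , class , class-size , λ c γ →
    (1 , λ j → resolution γ c j) , (1 , λ β _ → block-meets-row c (offset β) (class β))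

latinSemiRegular : ∀ {s t x b k} → suc t ≡ suc x * s →
  (D : RD (suc t) s b t k 0 x (suc x)) → LatinSemiRegular D
latinSemiRegular {s} {t} {x} m≡xs D = θ₁≡0 (+ t) (+ x) , θ₂≡0 , 0<θ₃
  where
  θ₁≡0 : ∀ t x → t - + 0 ℤ.+ ((+ 1 ℤ.+ t) - + 1) ℤ.* (x - (+ 1 ℤ.+ x)) ≡ + 0
  θ₁≡0 = ℤ-solve-∀

  θ₂≡0 : + t - + x ℤ.+ (+ s - + 1) ℤ.* (+ 0 - + suc x) ≡ + 0
  θ₂≡0 = begin
    + t - + x ℤ.+ (+ s - + 1) ℤ.* (+ 0 - + suc x)
      ≡⟨ rearrange (+ t) (+ x) (+ s) ⟩
    + suc t - + suc x ℤ.* + s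
      ≡⟨ cong (_- + suc x ℤ.* + s) (trans (cong +_ m≡xs) (ℤ.pos-* (suc x) s)) ⟩
    + suc x ℤ.* + s - + suc x ℤ.* + s
      ≡⟨ ℤ.+-inverseʳ (+ suc x ℤ.* + s) ⟩
    + 0
      ∎
    where
    open ≡-Reasoning
    rearrange : ∀ t x s → t - x ℤ.+ (s - + 1) ℤ.* (+ 0 - (+ 1 ℤ.+ x)) ≡ (+ 1 ℤ.+ t) - (+ 1 ℤ.+ x) ℤ.* s
    rearrange = ℤ-solve-∀

  0<θ₃ : + 0 ℤ.< + t - + 0 - + x ℤ.+ + suc x
  0<θ₃ = subst (+ 0 ℤ.<_) (sym (θ₃≡1+t (+ t) (+ x))) (ℤ.+<+ (s≤s z≤n))
    where θ₃≡1+t : ∀ t x → t - + 0 - x ℤ.+ (+ 1 ℤ.+ x) ≡ + 1 ℤ.+ t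
          θ₃≡1+t = ℤ-solve-∀

theorem10 : ∀ (x s : ℕ) .{{_ : NonZero s}} → 2 ≤ s → 1 ≤ x →
    DS (x * s) s x →
    Σ (RD (x * s) s (s * (x * s ∸ 1)) (x * s ∸ 1) (x * s) 0 (x ∸ 1) x) λ D →
    LatinSemiRegular D × AffineResolvable D 0 x × STD D
theorem10 (suc x) s@(suc _) _ _ (D , columns) =
  design , latinSemiRegular refl design , affine , std
  where
  open DifferenceSchemes s using (transpose-isDifferenceScheme)
  open Construction D columns (transpose-isDifferenceScheme (*-comm (suc x) s) D columns)
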